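{- Let $G$ and $H$ be graphs of orders $n_1$ and $n_2$ respectively. Then \[\frac{n_1n_2}{\mathrm{gp}(G\square H)}\le \chi_{\mathrm{gp}}(G\square H)\le \min\{n_1\chi_{\mathrm{gp}}(H),\ n_2\chi_{\mathrm{gp}}(G)\}.\]
   Context: $G\square H$ is the Cartesian product. A set is in general position if no shortest path contains more than two of its vertices; $\mathrm{gp}(X)$ is the maximum size of a general position set of $X$, and $\chi_{\mathrm{gp}}(X)$ is the minimum number of colours in a colouring of $V(X)$ with each colour class in general position. -}

module Defs where

open import Data.Nat using (ℕ; zero; suc; _≤_; _*_)
open import Data.Fin using (Fin; remQuot)
open import Data.Fin.Subset using (Subset; _∈_; ∣_∣; Side; inside; outside)
open import Data.Product using (_×_; _,_; proj₁; proj₂; ∃-syntax)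
open import Data.Sum using (_⊎_; inj₁; inj₂)
open import Relation.Binary.PropositionalEquality using (_≡_; _≢_; refl)
import Relation.Binary.PropositionalEquality as Eq
open import Relation.Nullary using (¬_; yes; no)
open import Data.Vec using (tabulate)
open import Data.Fin using (_≟_)

record Graph : Set₁ where
  field
    order : ℕ
    Adj   : Fin order → Fin order → Set
    adj-sym : ∀ {x y} → Adj x y → Adj y x
    adj-irr : ∀ {x} → ¬ Adj x x
open Graph public

_□_ : Graph → Graph → Graph
G □ H = record
  { order = order G * order H
  ; Adj   = λ x y → PAdj (remQuot (order H) x) (remQuot (order H) y)
  ; adj-sym = psym
  ; adj-irr = pirr
  }
  where
  PAdj : Fin (order G) × Fin (order H) → Fin (order G) × Fin (order H) → Set
  PAdj (g , h) (g′ , h′) = (Adj G g g′ × h ≡ h′) ⊎ (g ≡ g′ × Adj H h h′)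
  psym : ∀ {p q} → PAdj p q → PAdj q p
  psym (inj₁ (a , e)) = inj₁ (adj-sym G a , Eq.sym e)
  psym (inj₂ (e , a)) = inj₂ (Eq.sym e , adj-sym H a)
  pirr : ∀ {p} → ¬ PAdj p p
  pirr (inj₁ (a , _)) = adj-irr G a
  pirr (inj₂ (_ , a)) = adj-irr H a

data Walk (G : Graph) : Fin (order G) → Fin (order G) → ℕ → Set where
  here : ∀ {u} → Walk G u u zero
  step : ∀ {u w v k} → Adj G u w → Walk G w v k → Walk G u v (suc k)

data OnWalk (G : Graph) (x : Fin (order G)) : ∀ {u v k} → Walk G u v k → Set where
  on-here  : ∀ {v k} {p : Walk G x v k} → OnWalk G x p
  on-there : ∀ {u w v k} {a : Adj G u w} {p : Walk G w v k}
           → OnWalk G x p → OnWalk G x (step a p)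

IsGeodesic : (G : Graph) → ∀ {u v k} → Walk G u v k → Set
IsGeodesic G {u} {v} {k} _ = ∀ {k′} → Walk G u v k′ → k ≤ k′

InGeneralPosition : (G : Graph) → Subset (order G) → Set
InGeneralPosition G S =
  ∀ {u v k} (P : Walk G u v k) → IsGeodesic G P →
  ∀ x y z → x ∈ S → y ∈ S → z ∈ S → x ≢ y → y ≢ z → x ≢ z →
  ¬ (OnWalk G x P × OnWalk G y P × OnWalk G z P)

IsGpNumber : Graph → ℕ → Set
IsGpNumber G m =
  (∃[ S ] (InGeneralPosition G S × ∣ S ∣ ≡ m)) ×
  (∀ S → InGeneralPosition G S → ∣ S ∣ ≤ m)

ColourClass : ∀ {n k} → (Fin n → Fin k) → Fin k → Subset n
ColourClass c i = tabulate (λ v → side (c v))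
  where
  side : Fin _ → Side
  side j with j ≟ i
  ... | yes _ = inside
  ... | no  _ = outside

IsGpColouring : (G : Graph) (k : ℕ) → (Fin (order G) → Fin k) → Set
IsGpColouring G k c = ∀ i → InGeneralPosition G (ColourClass c i)

IsGpChromaticNumber : Graph → ℕ → Set
IsGpChromaticNumber G m =
  (∃[ c ] IsGpColouring G m c) ×
  (∀ k c → IsGpColouring G k c → m ≤ k)

-- The colour classes of a gp-colouring of G □ H partition its n₁n₂ vertices into sets of size at
-- most gp(G □ H), which gives the lower bound. For the upper bound, a geodesic of G □ H projects to
-- geodesics of both factors (a shorter walk in one factor, combined with the projection to the other,
-- would beat it). Colouring (g , h) by (g , c h) for a gp-colouring c of H, three vertices of one class
-- lie in a common H-fibre, so they project to three distinct vertices of one class of c on a geodesic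
-- of H; symmetrically with the roles of G and H exchanged.
module Submission where

open import Defs
open import Data.Nat using (ℕ; _≤_; _*_; _⊓_)
open import Data.Product using (_×_)

import Algebra.Properties.CommutativeMonoid.Sum
open import Data.Nat using (zero; suc; _+_; z≤n)
open import Data.Nat.Properties as ℕₚ
  using (+-0-commutativeMonoid; +-suc; +-mono-≤; *-comm; ⊓-glb; +-cancelˡ-≤; +-cancelʳ-≤)
open import Data.Product using (_,_; proj₁; proj₂; Σ-syntax)
open import Data.Sum using (inj₁; inj₂)
import Data.Fin as Fin
open import Data.Fin using (Fin; _≟_; remQuot; combine)
open import Data.Fin.Properties using (remQuot-combine; combine-remQuot; combine-injective)
open import Data.Fin.Subset using (Subset; Side; inside; outside; _∈_; ∣_∣)
open import Data.Vec using ([]; _∷_; lookup)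
open import Data.Vec.Properties using ([]=⇒lookup; lookup⇒[]=; lookup∘tabulate)
open import Function using (_∘_; _∋_)
open import Relation.Binary.PropositionalEquality
open import Relation.Nullary using (yes; no; does)
open import Relation.Nullary.Decidable using (dec-true)

open Algebra.Properties.CommutativeMonoid.Sum +-0-commutativeMonoid
  using (sum-syntax; ∑-comm; sum-replicate-zero; sum-cong-≗)

lookup-ColourClass : ∀ {n k} (c : Fin n → Fin k) i v → lookup (ColourClass c i) v ≡ does (c v ≟ i)
lookup-ColourClass c i v with c v ≟ i | (lookup (ColourClass c i) v ≡ _ ∋ lookup∘tabulate _ v)
... | yes _ | eq = eq
... | no _  | eq = eq

∈ColourClass⇒ : ∀ {n k} {c : Fin n → Fin k} {i v} → v ∈ ColourClass c i → c v ≡ i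
∈ColourClass⇒ {c = c} {i} {v} v∈ with c v ≟ i | trans (sym (lookup-ColourClass c i v)) ([]=⇒lookup v∈)
... | yes eq | _ = eq
... | no _   | ()

⇒∈ColourClass : ∀ {n k} {c : Fin n → Fin k} {i v} → c v ≡ i → v ∈ ColourClass c i
⇒∈ColourClass {c = c} {i} {v} refl = lookup⇒[]= v _ (trans (lookup-ColourClass c i v) (dec-true (c v ≟ i) refl))

indicator : Side → ℕ
indicator inside  = 1
indicator outside = 0

∣p∣≡∑indicator : ∀ {n} (p : Subset n) → ∣ p ∣ ≡ ∑[ v < n ] indicator (lookup p v)
∣p∣≡∑indicator []            = refl
∣p∣≡∑indicator (inside  ∷ p) = cong suc (∣p∣≡∑indicator p)
∣p∣≡∑indicator (outside ∷ p) = ∣p∣≡∑indicator p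

∑-indicator-≟ : ∀ {k} (j : Fin k) → ∑[ i < k ] indicator (does (j ≟ i)) ≡ 1
∑-indicator-≟ {suc k} Fin.zero    = cong suc (sum-replicate-zero k)
∑-indicator-≟         (Fin.suc j) = ∑-indicator-≟ j

∑-const-1 : ∀ n → ∑[ _ < n ] 1 ≡ n
∑-const-1 zero    = refl
∑-const-1 (suc n) = cong suc (∑-const-1 n)

∑≤*-bound : ∀ {k m} (f : Fin k → ℕ) → (∀ i → f i ≤ m) → ∑[ i < k ] f i ≤ k * m
∑≤*-bound {zero}  f f≤m = z≤n
∑≤*-bound {suc k} f f≤m = +-mono-≤ (f≤m Fin.zero) (∑≤*-bound (f ∘ Fin.suc) (f≤m ∘ Fin.suc))

∑-∣ColourClass∣ : ∀ {n k} (c : Fin n → Fin k) → ∑[ i < k ] ∣ ColourClass c i ∣ ≡ n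
∑-∣ColourClass∣ {n} {k} c = begin
  ∑[ i < k ] ∣ ColourClass c i ∣
    ≡⟨ sum-cong-≗ (∣p∣≡∑indicator ∘ ColourClass c) ⟩
  ∑[ i < k ] ∑[ v < n ] indicator (lookup (ColourClass c i) v)
    ≡⟨ sum-cong-≗ (λ i → sum-cong-≗ (cong indicator ∘ lookup-ColourClass c i)) ⟩
  ∑[ i < k ] ∑[ v < n ] indicator (does (c v ≟ i))
    ≡⟨ ∑-comm (λ i v → indicator (does (c v ≟ i))) ⟩
  ∑[ v < n ] ∑[ i < k ] indicator (does (c v ≟ i))
    ≡⟨ sum-cong-≗ (∑-indicator-≟ ∘ c) ⟩
  ∑[ v < n ] 1
    ≡⟨ ∑-const-1 n ⟩
  n ∎
  where open ≡-Reasoning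

order≤gp*colours : ∀ {X : Graph} {g k} {c : Fin (order X) → Fin k}
                 → (∀ S → InGeneralPosition X S → ∣ S ∣ ≤ g) → IsGpColouring X k c
                 → order X ≤ g * k
order≤gp*colours {X} {g} {k} {c} gp-bound c-gp = begin
  order X                       ≡⟨ ∑-∣ColourClass∣ c ⟨
  ∑[ i < k ] ∣ ColourClass c i ∣ ≤⟨ ∑≤*-bound _ (λ i → gp-bound _ (c-gp i)) ⟩
  k * g                         ≡⟨ *-comm k g ⟩
  g * k                         ∎
  where open ℕₚ.≤-Reasoning

ProjectsGeodesics : (X Y : Graph) → (Fin (order X) → Fin (order Y)) → Set
ProjectsGeodesics X Y f =
  ∀ {u v k} (P : Walk X u v k) → IsGeodesic X P →
  Σ[ l ∈ ℕ ] Σ[ Q ∈ Walk Y (f u) (f v) l ] IsGeodesic Y Q × (∀ {x} → OnWalk X x P → OnWalk Y (f x) Q)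

gpColouring-pullback : ∀ {X Y : Graph} {f : Fin (order X) → Fin (order Y)} {k m} {cY : Fin (order Y) → Fin m}
                     → ProjectsGeodesics X Y f → IsGpColouring Y m cY
                     → (c : Fin (order X) → Fin k)
                     → (∀ {x y} → c x ≡ c y → cY (f x) ≡ cY (f y))
                     → (∀ {x y} → c x ≡ c y → f x ≡ f y → x ≡ y)
                     → IsGpColouring X k c
gpColouring-pullback {f = f} {cY = cY} project cY-gp c c≡⇒cY≡ c≡⇒f-injective
                     i P P-geo x y z x∈ y∈ z∈ x≢y y≢z x≢z (x∈P , y∈P , z∈P)
  with _ , Q , Q-geo , onQ ← project P P-geo
  = cY-gp (cY (f x)) Q Q-geo (f x) (f y) (f z)
      (⇒∈ColourClass refl) (⇒∈ColourClass (sym (c≡⇒cY≡ cx≡cy))) (⇒∈ColourClass (sym (c≡⇒cY≡ cx≡cz)))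
      (x≢y ∘ c≡⇒f-injective cx≡cy) (y≢z ∘ c≡⇒f-injective cy≡cz) (x≢z ∘ c≡⇒f-injective cx≡cz)
      (onQ x∈P , onQ y∈P , onQ z∈P)
  where
  cx≡cy : c x ≡ c y
  cx≡cy = trans (∈ColourClass⇒ x∈) (sym (∈ColourClass⇒ y∈))
  cy≡cz : c y ≡ c z
  cy≡cz = trans (∈ColourClass⇒ y∈) (sym (∈ColourClass⇒ z∈))
  cx≡cz : c x ≡ c z
  cx≡cz = trans cx≡cy cy≡cz

castWalk : ∀ {X : Graph} {u u′ v v′ k} → u ≡ u′ → v ≡ v′ → Walk X u v k → Walk X u′ v′ k
castWalk refl refl P = P

onWalk-castWalk : ∀ {X : Graph} {x u u′ v v′ k} (u≡u′ : u ≡ u′) (v≡v′ : v ≡ v′) {P : Walk X u v k}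
                → OnWalk X x P → OnWalk X x (castWalk u≡u′ v≡v′ P)
onWalk-castWalk refl refl x∈P = x∈P

_++_ : ∀ {X : Graph} {u w v a b} → Walk X u w a → Walk X w v b → Walk X u v (a + b)
here     ++ Q = Q
step e P ++ Q = step e (P ++ Q)

module Product (G H : Graph) where

  π₁ : Fin (order (G □ H)) → Fin (order G)
  π₁ x = proj₁ (remQuot {order G} (order H) x)

  π₂ : Fin (order (G □ H)) → Fin (order H)
  π₂ x = proj₂ (remQuot {order G} (order H) x)

  π₁-combine : (g : Fin (order G)) (h : Fin (order H)) → π₁ (combine g h) ≡ g
  π₁-combine g h = cong proj₁ (remQuot-combine g h)

  π₂-combine : (g : Fin (order G)) (h : Fin (order H)) → π₂ (combine g h) ≡ h
  π₂-combine g h = cong proj₂ (remQuot-combine g h)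

  combine-π : ∀ x → combine (π₁ x) (π₂ x) ≡ x
  combine-π = combine-remQuot {order G} (order H)

  π-injective : ∀ {x y} → π₁ x ≡ π₁ y → π₂ x ≡ π₂ y → x ≡ y
  π-injective {x} {y} π₁≡ π₂≡ = begin
    x                        ≡⟨ combine-π x ⟨
    combine (π₁ x) (π₂ x)    ≡⟨ cong₂ combine π₁≡ π₂≡ ⟩
    combine (π₁ y) (π₂ y)    ≡⟨ combine-π y ⟩
    y                        ∎
    where open ≡-Reasoning

  adjˡ : ∀ {g g′} (h : Fin (order H)) → Adj G g g′ → Adj (G □ H) (combine g h) (combine g′ h)
  adjˡ {g} {g′} h a = inj₁ ( subst₂ (Adj G) (sym (π₁-combine g h)) (sym (π₁-combine g′ h)) a
                           , trans (π₂-combine g h) (sym (π₂-combine g′ h)))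

  adjʳ : ∀ {h h′} (g : Fin (order G)) → Adj H h h′ → Adj (G □ H) (combine g h) (combine g h′)
  adjʳ {h} {h′} g a = inj₂ ( trans (π₁-combine g h) (sym (π₁-combine g h′))
                           , subst₂ (Adj H) (sym (π₂-combine g h)) (sym (π₂-combine g h′)) a)

  liftG : ∀ {g g′ a} → Walk G g g′ a → (h : Fin (order H)) → Walk (G □ H) (combine g h) (combine g′ h) a
  liftG here       h = here
  liftG (step a P) h = step (adjˡ h a) (liftG P h)

  liftH : ∀ {h h′ b} → Walk H h h′ b → (g : Fin (order G)) → Walk (G □ H) (combine g h) (combine g h′) b
  liftH here       g = here
  liftH (step a P) g = step (adjʳ g a) (liftH P g)

  combineWalks : ∀ {u v a b} → Walk G (π₁ u) (π₁ v) a → Walk H (π₂ u) (π₂ v) b → Walk (G □ H) u v (a + b)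
  combineWalks {u} {v} P Q = castWalk (combine-π u) (combine-π v) (liftG P (π₂ u) ++ liftH Q (π₁ v))

  lengthG lengthH : ∀ {u v k} → Walk (G □ H) u v k → ℕ
  lengthG here              = 0
  lengthG (step (inj₁ _) P) = suc (lengthG P)
  lengthG (step (inj₂ _) P) = lengthG P
  lengthH here              = 0
  lengthH (step (inj₁ _) P) = lengthH P
  lengthH (step (inj₂ _) P) = suc (lengthH P)

  lengthG+lengthH : ∀ {u v k} (P : Walk (G □ H) u v k) → lengthG P + lengthH P ≡ k
  lengthG+lengthH here              = refl
  lengthG+lengthH (step (inj₁ _) P) = cong suc (lengthG+lengthH P)
  lengthG+lengthH (step (inj₂ _) P) = trans (+-suc (lengthG P) (lengthH P)) (cong suc (lengthG+lengthH P))

  projectG : ∀ {u v k} (P : Walk (G □ H) u v k) → Walk G (π₁ u) (π₁ v) (lengthG P)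
  projectG here                    = here
  projectG (step (inj₁ (a , _)) P) = step a (projectG P)
  projectG (step (inj₂ (e , _)) P) = castWalk (sym e) refl (projectG P)

  projectH : ∀ {u v k} (P : Walk (G □ H) u v k) → Walk H (π₂ u) (π₂ v) (lengthH P)
  projectH here                    = here
  projectH (step (inj₁ (_ , e)) P) = castWalk (sym e) refl (projectH P)
  projectH (step (inj₂ (_ , a)) P) = step a (projectH P)

  onWalk-projectG : ∀ {x u v k} {P : Walk (G □ H) u v k} → OnWalk (G □ H) x P → OnWalk G (π₁ x) (projectG P)
  onWalk-projectG on-here                           = on-here
  onWalk-projectG (on-there {a = inj₁ _} x∈P)       = on-there (onWalk-projectG x∈P)
  onWalk-projectG (on-there {a = inj₂ (e , _)} x∈P) = onWalk-castWalk (sym e) refl (onWalk-projectG x∈P)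

  onWalk-projectH : ∀ {x u v k} {P : Walk (G □ H) u v k} → OnWalk (G □ H) x P → OnWalk H (π₂ x) (projectH P)
  onWalk-projectH on-here                           = on-here
  onWalk-projectH (on-there {a = inj₁ (_ , e)} x∈P) = onWalk-castWalk (sym e) refl (onWalk-projectH x∈P)
  onWalk-projectH (on-there {a = inj₂ _} x∈P)       = on-there (onWalk-projectH x∈P)

  projectG-geodesic : ∀ {u v k} (P : Walk (G □ H) u v k) → IsGeodesic (G □ H) P → IsGeodesic G (projectG P)
  projectG-geodesic P P-geo Q = +-cancelʳ-≤ (lengthH P) _ _
    (subst (_≤ _ + lengthH P) (sym (lengthG+lengthH P)) (P-geo (combineWalks Q (projectH P))))

  projectH-geodesic : ∀ {u v k} (P : Walk (G □ H) u v k) → IsGeodesic (G □ H) P → IsGeodesic H (projectH P)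
  projectH-geodesic P P-geo Q = +-cancelˡ-≤ (lengthG P) _ _
    (subst (_≤ lengthG P + _) (sym (lengthG+lengthH P)) (P-geo (combineWalks (projectG P) Q)))

  π₁-projectsGeodesics : ProjectsGeodesics (G □ H) G π₁
  π₁-projectsGeodesics P P-geo = _ , projectG P , projectG-geodesic P P-geo , onWalk-projectG

  π₂-projectsGeodesics : ProjectsGeodesics (G □ H) H π₂
  π₂-projectsGeodesics P P-geo = _ , projectH P , projectH-geodesic P P-geo , onWalk-projectH

  liftGpColouringʳ : ∀ {m} {c : Fin (order H) → Fin m} → IsGpColouring H m c
                   → IsGpColouring (G □ H) (order G * m) (λ x → combine (π₁ x) (c (π₂ x)))
  liftGpColouringʳ {c = c} c-gp =
    gpColouring-pullback π₂-projectsGeodesics c-gp _ (proj₂ ∘ split) (π-injective ∘ proj₁ ∘ split)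
    where
    split : ∀ {x y} → combine (π₁ x) (c (π₂ x)) ≡ combine (π₁ y) (c (π₂ y)) → π₁ x ≡ π₁ y × c (π₂ x) ≡ c (π₂ y)
    split = combine-injective _ _ _ _

  liftGpColouringˡ : ∀ {m} {c : Fin (order G) → Fin m} → IsGpColouring G m c
                   → IsGpColouring (G □ H) (order H * m) (λ x → combine (π₂ x) (c (π₁ x)))
  liftGpColouringˡ {c = c} c-gp =
    gpColouring-pullback π₁-projectsGeodesics c-gp _ (proj₂ ∘ split) (λ e π₁≡ → π-injective π₁≡ (proj₁ (split e)))
    where
    split : ∀ {x y} → combine (π₂ x) (c (π₁ x)) ≡ combine (π₂ y) (c (π₁ y)) → π₂ x ≡ π₂ y × c (π₁ x) ≡ c (π₁ y)
    split = combine-injective _ _ _ _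

mainTheorem18 : (G H : Graph) (gpGH χGH χG χH : ℕ)
    → IsGpNumber (G □ H) gpGH
    → IsGpChromaticNumber (G □ H) χGH
    → IsGpChromaticNumber G χG
    → IsGpChromaticNumber H χH
    → (order G * order H ≤ gpGH * χGH)
    × (χGH ≤ (order G * χH) ⊓ (order H * χG))
mainTheorem18 G H gpGH χGH χG χH (_ , gp-maximal) ((_ , c-gp) , χGH-minimal) ((_ , cG-gp) , _) ((_ , cH-gp) , _) =
    order≤gp*colours gp-maximal c-gp
  , ⊓-glb (χGH-minimal _ _ (liftGpColouringʳ cH-gp)) (χGH-minimal _ _ (liftGpColouringˡ cG-gp))
  where open Product G H
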